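{- Let $(h,\ast,1)$ be an associative presheaf and let $\mathrm{Alg}(h)=\operatorname{span}_{\mathbb Q}(\mathcal G(h),\cdot)$ be the algebra spanned by $\mathcal G(h)$ with product $\cdot$. Identifying functions $\mathcal G(h)\to\mathbb Q$ with linear functionals on $\mathrm{Alg}(h)$, we have $\mathcal A(h)\subseteq\mathrm{Alg}(h)^{\circ}$, where $\mathrm{Alg}(h)^\circ=\{g\in\mathrm{Alg}(h)^*:\ker g\text{ contains an ideal } J \text{ with } \mathrm{Alg}(h)/J \text{ finite dimensional}\}$ is the Sweedler dual.
   Context: A combinatorial presheaf $h$ is a contravariant functor from finite sets with injections to finite sets; $h[I]$ are objects on $I$, $a|_J$ restriction. $a\sim b$ if related by a relabeling bijection; $\mathcal G(h)=\biguplus_n h[[n]]/\sim$. For $b\in h[I]$, $\mathrm{p}_a(b)=|\{J'\subseteq I:b|_{J'}\sim a\}|$; $\mathcal A(h)$ is the $\mathbb Q$-span of $\{\mathrm{p}_a:a\in\mathcal G(h)\}$. An associative presheaf $(h,\ast,1)$ has products $h[I]\times h[J]\to h[I\sqcup J]$ for disjoint $I,J$, natural in relabelings, with $(a\ast b)|_{A\sqcup B}=a|_A\ast b|_B$, associative, unit $1\in h[\emptyset]$. The induced product on $\mathcal G(h)$: for $a\in h[[n_1]],b\in h[[n_2]]$, $\bar a\cdot\bar b$ is the class of $a\ast b'$, $b'$ being $b$ relabeled order-preservingly to $\{n_1+1,\dots,n_1+n_2\}$. -}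

module Defs where

open import Data.Nat using (ℕ; zero; suc; _+_)
open import Data.Nat.Properties using (+-assoc; +-identityʳ)
open import Data.Fin using (Fin; zero; suc; splitAt; join)
open import Data.Fin.Properties using (all?; any?) renaming (_≟_ to _≟F_)
open import Data.Sum using (map)
open import Data.Product using (Σ; Σ-syntax; ∃; _,_; _×_; proj₁; proj₂)
open import Data.Bool using (Bool; true; false; _∧_)
open import Data.Vec using (Vec; []; _∷_; tabulate)
open import Data.List using (List; []; _∷_; [_]; concatMap; allFin; length; filterᵇ; _++_; foldr)
import Data.List as L
open import Data.Bool.ListAction using (any)
open import Data.Integer using (+_)
open import Data.Rational using (ℚ; _/_; _*_; -_) renaming (_+_ to _+ℚ_; 0ℚ to 0q)
open import Function using (_∘_; id; _↔_)
open import Function.Definitions using (Injective)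
open import Relation.Nullary using (Dec; yes; no; does; ¬_)
open import Relation.Nullary.Decidable using (_→-dec_; map′)
open import Relation.Binary.PropositionalEquality using (_≡_; refl; subst)
open import Relation.Binary.Definitions using (DecidableEquality)
import Data.Vec.Properties as VP
import Data.Bool.Properties as BP

-- Finite sets with injections are modelled by their skeleton: the sets
-- Fin n with injective maps.

Inj : ∀ {k n} → (Fin k → Fin n) → Set
Inj f = Injective _≡_ _≡_ f

_⊕_ : ∀ {k l n m} → (Fin k → Fin n) → (Fin l → Fin m) → Fin (k + l) → Fin (n + m)
_⊕_ {k} {l} {n} {m} α β = join n m ∘ map α β ∘ splitAt k

record AssocPresheaf : Set₁ where
  field
    h      : ℕ → Set
    finite : ∀ n → Σ ℕ λ c → Fin c ↔ h n
    res    : ∀ {m n} (f : Fin m → Fin n) → Inj f → h n → h m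
    res-irr : ∀ {m n} (f g : Fin m → Fin n) (p : Inj f) (q : Inj g) →
              (∀ i → f i ≡ g i) → ∀ x → res f p x ≡ res g q x
    res-id : ∀ {n} (p : Inj {n} id) x → res id p x ≡ x
    res-∘  : ∀ {k m n} (f : Fin m → Fin n) (g : Fin k → Fin m)
               (pf : Inj f) (pg : Inj g) (pfg : Inj (f ∘ g)) x →
               res (f ∘ g) pfg x ≡ res g pg (res f pf x)
    _∗_    : ∀ {n m} → h n → h m → h (n + m)
    one    : h 0
    res-∗  : ∀ {k l n m} (α : Fin k → Fin n) (β : Fin l → Fin m)
               (pα : Inj α) (pβ : Inj β) (p : Inj (α ⊕ β)) a b →
               res (α ⊕ β) p (a ∗ b) ≡ res α pα a ∗ res β pβ b
    ∗-assoc : ∀ {n m k} (a : h n) (b : h m) (c : h k) →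
               subst h (+-assoc n m k) ((a ∗ b) ∗ c) ≡ a ∗ (b ∗ c)
    ∗-unitˡ : ∀ {n} (a : h n) → one ∗ a ≡ a
    ∗-unitʳ : ∀ {n} (a : h n) → subst h (+-identityʳ n) (a ∗ one) ≡ a

module _ (H : AssocPresheaf) where
  open AssocPresheaf H

  _≟h_ : ∀ {n} → DecidableEquality (h n)
  _≟h_ {n} x y with finite n
  ... | c , e = map′ (λ q → Data.Product.proj₂ (lem x y q)) (λ { refl → refl })
                     (from x ≟F from y)
    where
    open Function.Inverse e
    lem : ∀ x y → from x ≡ from y → from x ≡ from y × x ≡ y
    lem x y q = q , Relation.Binary.PropositionalEquality.trans
      (Relation.Binary.PropositionalEquality.sym (strictlyInverseˡ x))
      (Relation.Binary.PropositionalEquality.trans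
        (Relation.Binary.PropositionalEquality.cong to q) (strictlyInverseˡ y))

  -- objects: representatives of elements of G(h)
  Obj : Set
  Obj = Σ ℕ h

  allFuns : ∀ k n → List (Fin k → Fin n)
  allFuns zero n = [ (λ ()) ]
  allFuns (suc k) n = concatMap (λ f → L.map (λ j → cons j f) (allFin n)) (allFuns k n)
    where
    cons : Fin n → (Fin k → Fin n) → Fin (suc k) → Fin n
    cons j f zero = j
    cons j f (suc i) = f i

  allSubsets : ∀ n → List (Vec Bool n)
  allSubsets zero = [ [] ]
  allSubsets (suc n) = concatMap (λ S → (true ∷ S) ∷ (false ∷ S) ∷ []) (allSubsets n)

  inj? : ∀ {k n} (f : Fin k → Fin n) → Dec (∀ i j → f i ≡ f j → i ≡ j)
  inj? f = all? (λ i → all? (λ j → (f i ≟F f j) →-dec (i ≟F j)))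

  image : ∀ {k n} → (Fin k → Fin n) → Vec Bool n
  image f = tabulate (λ j → does (any? (λ i → f i ≟F j)))

  check : ∀ {k n} (a : h k) (b : h n) (S : Vec Bool n) → (Fin k → Fin n) → Bool
  check a b S ι with inj? ι
  ... | no _ = false
  ... | yes p = does (VP.≡-dec BP._≟_ (image ι) S) ∧ does (res ι (λ {i} {j} → p i j) b ≟h a)

  -- p_a(b) = #{ J' ⊆ [n] : b|_{J'} ∼ a }
  pcount : Obj → Obj → ℕ
  pcount (k , a) (n , b) =
    length (filterᵇ (λ S → any (check a b S) (allFuns k n)) (allSubsets n))

  ℕtoℚ : ℕ → ℚ
  ℕtoℚ c = (+ c) / 1

  Alg : Set
  Alg = List (ℚ × Obj)

  _⊞_ : Alg → Alg → Alg
  _⊞_ = _++_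

  _⊙_ : ℚ → Alg → Alg
  c ⊙ x = L.map (λ t → (c * proj₁ t , proj₂ t)) x

  _·o_ : Obj → Obj → Obj
  (n , a) ·o (m , b) = (n + m , a ∗ b)

  _·_ : Alg → Alg → Alg
  x · y = concatMap (λ s → L.map (λ t → (proj₁ s * proj₁ t , proj₂ s ·o proj₂ t)) y) x

  lin : (Obj → ℚ) → Alg → ℚ
  lin φ x = foldr (λ t r → proj₁ t * φ (proj₂ t) +ℚ r) 0q x

  -- functions on objects that are invariant under relabeling (functions on G(h))
  Invariant : (Obj → ℚ) → Set
  Invariant φ = ∀ n (σ : Fin n → Fin n) (p : Inj σ) (b : h n) → φ (n , res σ p b) ≡ φ (n , b)

  -- equality in Alg(h) = span_Q G(h)
  _≈_ : Alg → Alg → Set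
  x ≈ y = ∀ φ → Invariant φ → lin φ x ≡ lin φ y

  record IsIdeal (J : Alg → Set) : Set where
    field
      resp : ∀ x y → x ≈ y → J x → J y
      zero∈ : J []
      ⊞∈ : ∀ x y → J x → J y → J (x ⊞ y)
      ⊙∈ : ∀ c x → J x → J (c ⊙ x)
      ·ˡ∈ : ∀ y x → J x → J (y · x)
      ·ʳ∈ : ∀ x y → J x → J (x · y)

  FinCodim : (Alg → Set) → Set
  FinCodim J = Σ ℕ λ m → Σ (Fin m → Alg) λ v →
    ∀ x → Σ (Fin m → ℚ) λ c →
      J (x ⊞ ((- (+ 1 / 1)) ⊙ foldr (λ i r → (c i ⊙ v i) ⊞ r) [] (allFin m)))

  InSweedler : (Obj → ℚ) → Set₁
  InSweedler g = Σ (Alg → Set) λ J → IsIdeal J × FinCodim J × (∀ x → J x → lin g x ≡ 0q)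

  pcomb : List (ℚ × Obj) → Obj → ℚ
  pcomb cs b = foldr (λ t r → proj₁ t * ℕtoℚ (pcount (proj₂ t) b) +ℚ r) 0q cs

-- For b ∈ h[n] let μ(b) = Σ_{S ⊆ [n]} (−1)^{n−|S|} b|_S be its Möbius transform.  Since the
-- product is compatible with restrictions and the subsets of [n+m] are exactly the S ⊔ T,
-- μ(a · b) = μ(a) · μ(b).  As b is the leading term of μ(b) and all other terms are smaller,
-- the μ(b) span Alg(h).  Hence for each K the span J_K of the μ(b) with |b| > K is an ideal,
-- and Alg(h)/J_K is spanned by the finitely many objects of size ≤ K.  Finally, by Möbius
-- inversion p_a(μ(b)) = Σ_S (−1)^{n−|S|} #{T ⊆ S : b|_T ∼ a} = [b ∼ a], which vanishes when
-- |a| < |b|; so for K the largest size in Σ c_i p_{a_i}, the kernel of this functional contains J_K.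

module Submission where

open import Defs
open import Data.List using (List)
open import Data.Product using (_×_)
open import Data.Rational using (ℚ)

open import Data.Bool using (Bool; true; false; _∧_)
open import Data.Bool.ListAction using (any)
import Data.Bool.Properties as Bool
open import Data.Empty using (⊥; ⊥-elim)
open import Data.Fin using (Fin; zero; suc; splitAt; join; cast; punchOut)
import Data.Fin.Properties as Fin
open import Data.Fin.Subset using (Subset; ∣_∣; ⊤)
open import Data.Fin.Subset.Properties using (∣⊤∣≡n)
import Data.Integer as ℤ
import Data.Integer.Properties as ℤ
open import Data.List using ([]; _∷_; [_]; _++_; foldr; map; concatMap; length; filterᵇ; allFin; upTo; lookup)
open import Data.List.Extrema.Nat using (max; xs≤max)
open import Data.List.Membership.Propositional using (_∈_)
open import Data.List.Membership.Propositional.Properties using (∈-concat⁺′; ∈-map⁺; ∈-upTo⁺; ∈-allFin)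
import Data.List.Properties as List
open import Data.List.Relation.Unary.All using (All; []; _∷_)
import Data.List.Relation.Unary.All as All
import Data.List.Relation.Unary.All.Properties as AllP
open import Data.List.Relation.Unary.Any using (Any; here; index)
import Data.List.Relation.Unary.Any as Any
import Data.List.Relation.Unary.Any.Properties as AnyP
open import Data.List.Relation.Unary.Any.Properties using (lookup-index)
open import Data.Nat using (ℕ; suc; _≤_; _<_; s≤s) renaming (_+_ to _+ℕ_; _*_ to _*ℕ_)
import Data.Nat.Coprimality as Coprime
open import Data.Nat.Induction using (<-rec)
import Data.Nat.Properties as ℕ
open import Data.Product using (∃; _,_; proj₁; proj₂)
open import Data.Rational using (0ℚ; 1ℚ; _+_; _*_; -_; _/_; mkℚ)
open import Data.Rational.Properties
  using (*-zeroʳ; *-zeroˡ; *-distribˡ-+; *-distribʳ-+; +-identityˡ; +-identityʳ; +-assoc; *-assoc;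
         *-identityˡ; *-identityʳ; neg-distribˡ-*; normalize-coprime)
open import Data.Rational.Solver using (module +-*-Solver)
open import Data.Sum using (inj₁; inj₂)
import Data.Sum as Sum
import Data.Sum.Properties as Sum
open import Data.Vec using ([]; _∷_)
import Data.Vec as Vec
import Data.Vec.Properties as VP
open import Data.Vec.Relation.Binary.Pointwise.Extensional using (ext; Pointwise-≡⇒≡)
open import Function using (_∘_; id)
open import Function.Bundles using (mk⇔; Inverse; Equivalence)
open import Relation.Binary.PropositionalEquality hiding ([_])
open import Relation.Nullary using (Dec; yes; no; does; ¬_)
open import Relation.Nullary.Decidable using (dec-true; does-⇔; _×-dec_)

open +-*-Solver

-- Finite sums

∑ : {X : Set} → List X → (X → ℚ) → ℚ
∑ xs F = foldr (λ x r → F x + r) 0ℚ xs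

syntax ∑ xs (λ x → F) = ∑[ x ∈ xs ] F

private variable X Y : Set

∑-cong : ∀ (xs : List X) {F G : X → ℚ} → (∀ x → F x ≡ G x) → ∑ xs F ≡ ∑ xs G
∑-cong []       F≗G = refl
∑-cong (x ∷ xs) F≗G = cong₂ _+_ (F≗G x) (∑-cong xs F≗G)

∑-zero : ∀ (xs : List X) → ∑[ _ ∈ xs ] 0ℚ ≡ 0ℚ
∑-zero []       = refl
∑-zero (x ∷ xs) = trans (+-identityˡ _) (∑-zero xs)

∑-distrib-+ : ∀ (xs : List X) (F G : X → ℚ) → ∑[ x ∈ xs ] (F x + G x) ≡ ∑ xs F + ∑ xs G
∑-distrib-+ []       F G = refl
∑-distrib-+ (x ∷ xs) F G rewrite ∑-distrib-+ xs F G =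
  solve 4 (λ a b c d → (a :+ b) :+ (c :+ d) := (a :+ c) :+ (b :+ d)) refl (F x) (G x) (∑ xs F) (∑ xs G)

∑-factorˡ : ∀ (xs : List X) (c : ℚ) (F : X → ℚ) → ∑[ x ∈ xs ] (c * F x) ≡ c * ∑ xs F
∑-factorˡ []       c F = sym (*-zeroʳ c)
∑-factorˡ (x ∷ xs) c F rewrite ∑-factorˡ xs c F = sym (*-distribˡ-+ c (F x) (∑ xs F))

∑-++ : ∀ (xs ys : List X) (F : X → ℚ) → ∑ (xs ++ ys) F ≡ ∑ xs F + ∑ ys F
∑-++ []       ys F = sym (+-identityˡ _)
∑-++ (x ∷ xs) ys F rewrite ∑-++ xs ys F = sym (+-assoc (F x) (∑ xs F) (∑ ys F))

∑-comm : (xs : List X) (ys : List Y) (F : X → Y → ℚ) →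
         ∑[ x ∈ xs ] ∑[ y ∈ ys ] F x y ≡ ∑[ y ∈ ys ] ∑[ x ∈ xs ] F x y
∑-comm []       ys F = sym (∑-zero ys)
∑-comm (x ∷ xs) ys F rewrite ∑-comm xs ys F =
  sym (∑-distrib-+ ys (F x) (λ y → ∑[ x ∈ xs ] F x y))

∑-map : (f : X → Y) (xs : List X) (F : Y → ℚ) → ∑ (map f xs) F ≡ ∑[ x ∈ xs ] F (f x)
∑-map f []       F = refl
∑-map f (x ∷ xs) F = cong (F (f x) +_) (∑-map f xs F)

∑-concatMap : (f : X → List Y) (xs : List X) (F : Y → ℚ) →
              ∑ (concatMap f xs) F ≡ ∑[ x ∈ xs ] ∑ (f x) F
∑-concatMap f []       F = refl
∑-concatMap f (x ∷ xs) F =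
  trans (∑-++ (f x) (concatMap f xs) F) (cong (∑ (f x) F +_) (∑-concatMap f xs F))

𝟙 : Bool → ℚ
𝟙 true  = 1ℚ
𝟙 false = 0ℚ

δ : ∀ {m} → Fin m → Fin m → ℚ
δ i j = 𝟙 (does (i Fin.≟ j))

∑-allFin-suc : ∀ m (F : Fin (suc m) → ℚ) → ∑ (allFin (suc m)) F ≡ F zero + ∑[ i ∈ allFin m ] F (suc i)
∑-allFin-suc m F = cong (F zero +_) (trans (cong (λ is → ∑ is F) (sym (List.map-tabulate id suc))) (∑-map suc (allFin m) F))

∑-allFin-δ : ∀ m (j : Fin m) (G : Fin m → ℚ) → ∑[ i ∈ allFin m ] (δ j i * G i) ≡ G j
∑-allFin-δ (suc m) zero    G = begin
  ∑[ i ∈ allFin (suc m) ] (δ zero i * G i)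
    ≡⟨ ∑-allFin-suc m (λ i → δ zero i * G i) ⟩
  1ℚ * G zero + ∑[ i ∈ allFin m ] (0ℚ * G (suc i))
    ≡⟨ cong₂ _+_ (*-identityˡ (G zero)) (trans (∑-cong (allFin m) (λ i → *-zeroˡ (G (suc i)))) (∑-zero (allFin m))) ⟩
  G zero + 0ℚ
    ≡⟨ +-identityʳ (G zero) ⟩
  G zero ∎
  where open ≡-Reasoning
∑-allFin-δ (suc m) (suc j) G = begin
  ∑[ i ∈ allFin (suc m) ] (δ (suc j) i * G i)
    ≡⟨ ∑-allFin-suc m (λ i → δ (suc j) i * G i) ⟩
  0ℚ * G zero + ∑[ i ∈ allFin m ] (δ j i * G (suc i))
    ≡⟨ cong₂ _+_ (*-zeroˡ (G zero)) (∑-allFin-δ m j (G ∘ suc)) ⟩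
  0ℚ + G (suc j)
    ≡⟨ +-identityˡ (G (suc j)) ⟩
  G (suc j) ∎
  where open ≡-Reasoning

suc/1≡1+/1 : ∀ c → (ℤ.+ suc c) / 1 ≡ 1ℚ + (ℤ.+ c) / 1
suc/1≡1+/1 c =
  trans (cong (λ z → (ℤ.+ 1 ℤ.+ z) / 1) (trans (cong ℤ.+_ (sym (ℕ.*-identityʳ c))) (sym (ℤ.+◃n≡+n (c *ℕ 1)))))
        (cong₂ _+_ (sym (ℕ/1≡mkℚ 1)) (sym (ℕ/1≡mkℚ c)))
  where
  ℕ/1≡mkℚ : ∀ c → (ℤ.+ c) / 1 ≡ mkℚ (ℤ.+ c) 0 (Coprime.sym (Coprime.1-coprimeTo c))
  ℕ/1≡mkℚ c = normalize-coprime _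

length-filterᵇ/1 : (P : X → Bool) (xs : List X) → (ℤ.+ length (filterᵇ P xs)) / 1 ≡ ∑[ x ∈ xs ] 𝟙 (P x)
length-filterᵇ/1 P []       = refl
length-filterᵇ/1 P (x ∷ xs) with P x
... | true  = trans (suc/1≡1+/1 (length (filterᵇ P xs))) (cong (1ℚ +_) (length-filterᵇ/1 P xs))
... | false = trans (length-filterᵇ/1 P xs) (sym (+-identityˡ _))

-- Injections and subsets of Fin n

id-injective : ∀ {n} → Inj {n} id
id-injective e = e

⊕-injective : ∀ {k l n m} {α : Fin k → Fin n} {β : Fin l → Fin m} → Inj α → Inj β → Inj (α ⊕ β)
⊕-injective {k} {l} {n} {m} {α} {β} α-inj β-inj {x} {y} eq =
  trans (sym (Fin.join-splitAt k l x))
        (trans (cong (join k l) (map-injective {splitAt k x} {splitAt k y} split-eq)) (Fin.join-splitAt k l y))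
  where
  split-eq : Sum.map α β (splitAt k x) ≡ Sum.map α β (splitAt k y)
  split-eq = trans (sym (Fin.splitAt-join n m _)) (trans (cong (splitAt n) eq) (Fin.splitAt-join n m _))

  map-injective : ∀ {u v} → Sum.map α β u ≡ Sum.map α β v → u ≡ v
  map-injective {inj₁ u} {inj₁ v} e = cong inj₁ (α-inj (Sum.inj₁-injective e))
  map-injective {inj₂ u} {inj₂ v} e = cong inj₂ (β-inj (Sum.inj₂-injective e))
  map-injective {inj₁ u} {inj₂ v} ()
  map-injective {inj₂ u} {inj₁ v} ()

injective⇒surjective : ∀ {n} {σ : Fin n → Fin n} → Inj σ → ∀ j → ∃ λ i → σ i ≡ j
injective⇒surjective {suc n} {σ} σ-inj j with Fin.any? (λ i → σ i Fin.≟ j)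
... | yes hit = hit
... | no miss = ⊥-elim (Fin.<⇒notInjective (ℕ.n<1+n n) σ-avoiding-j-injective)
  where
  σ-avoiding-j : Fin (suc n) → Fin n
  σ-avoiding-j i = punchOut {i = j} {j = σ i} (λ e → miss (i , sym e))

  σ-avoiding-j-injective : Inj σ-avoiding-j
  σ-avoiding-j-injective {x} {y} e =
    σ-inj (Fin.punchOut-injective (λ e → miss (x , sym e)) (λ e → miss (y , sym e)) e)

from-does : ∀ {P : Set} (d : Dec P) → does d ≡ true → P
from-does (yes p) _ = p

any≡true⇒Any : ∀ (p : X → Bool) xs → any p xs ≡ true → Any (λ x → p x ≡ true) xs
any≡true⇒Any p xs found = Any.map (Equivalence.to Bool.T-≡) (AnyP.any⁻ p xs (Equivalence.from Bool.T-≡ found))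

Any⇒any≡true : ∀ (p : X → Bool) xs → Any (λ x → p x ≡ true) xs → any p xs ≡ true
Any⇒any≡true p xs hit = Equivalence.to Bool.T-≡ (AnyP.any⁺ p (Any.map (Equivalence.from Bool.T-≡) hit))

_∈ₛ_ : ∀ {n} → Fin n → Subset n → Set
j ∈ₛ S = Vec.lookup S j ≡ true

subset-ext : ∀ {n} {S T : Subset n} → (∀ j → j ∈ₛ S → j ∈ₛ T) → (∀ j → j ∈ₛ T → j ∈ₛ S) → S ≡ T
subset-ext S⊆T T⊆S = Pointwise-≡⇒≡ (ext (λ j → Bool.⇔→≡ (mk⇔ (S⊆T j) (T⊆S j))))

embed : ∀ {n} (S : Subset n) → Fin ∣ S ∣ → Fin n
embed (true  ∷ S) zero    = zero
embed (true  ∷ S) (suc i) = suc (embed S i)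
embed (false ∷ S) i       = suc (embed S i)

embed-injective : ∀ {n} (S : Subset n) → Inj (embed S)
embed-injective (true  ∷ S) {zero}  {zero}  e = refl
embed-injective (true  ∷ S) {suc x} {suc y} e = cong suc (embed-injective S (Fin.suc-injective e))
embed-injective (false ∷ S)                 e = embed-injective S (Fin.suc-injective e)

∣S++T∣≡∣S∣+∣T∣ : ∀ {n m} (S : Subset n) (T : Subset m) → ∣ S Vec.++ T ∣ ≡ ∣ S ∣ +ℕ ∣ T ∣
∣S++T∣≡∣S∣+∣T∣ []          T = refl
∣S++T∣≡∣S∣+∣T∣ (true  ∷ S) T = cong suc (∣S++T∣≡∣S∣+∣T∣ S T)
∣S++T∣≡∣S∣+∣T∣ (false ∷ S) T = ∣S++T∣≡∣S∣+∣T∣ S T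

embed-++ : ∀ {n m} (S : Subset n) (T : Subset m) (i : Fin ∣ S Vec.++ T ∣) →
           embed (S Vec.++ T) i ≡ (embed S ⊕ embed T) (cast (∣S++T∣≡∣S∣+∣T∣ S T) i)
embed-++ []          T i = cong (embed T) (sym (Fin.cast-is-id refl i))
embed-++ (true  ∷ S) T zero    = refl
embed-++ (true  ∷ S) T (suc i) = trans (cong suc (embed-++ S T i)) (suc-⊕ (splitAt ∣ S ∣ (cast _ i)))
  where
  suc-⊕ : ∀ u → suc (join _ _ (Sum.map (embed S) (embed T) u))
              ≡ join _ _ (Sum.map (embed (true ∷ S)) (embed T) (Sum.map₁ suc u))
  suc-⊕ (inj₁ _) = refl
  suc-⊕ (inj₂ _) = refl
embed-++ (false ∷ S) T i = trans (cong suc (embed-++ S T i)) (suc-⊕ (splitAt ∣ S ∣ (cast _ i)))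
  where
  suc-⊕ : ∀ u → suc (join _ _ (Sum.map (embed S) (embed T) u))
              ≡ join _ _ (Sum.map (embed (false ∷ S)) (embed T) u)
  suc-⊕ (inj₁ _) = refl
  suc-⊕ (inj₂ _) = refl

embed-⊤ : ∀ n (i : Fin ∣ ⊤ {n} ∣) → embed ⊤ i ≡ cast (∣⊤∣≡n n) i
embed-⊤ (suc n) zero    = refl
embed-⊤ (suc n) (suc i) = cong suc (embed-⊤ n i)

-- sign S = (−1)^(n − ∣ S ∣), the Möbius function of the Boolean lattice.
sign : ∀ {n} → Subset n → ℚ
sign []          = 1ℚ
sign (true  ∷ S) = sign S
sign (false ∷ S) = - sign S

sign-++ : ∀ {n m} (S : Subset n) (T : Subset m) → sign (S Vec.++ T) ≡ sign S * sign T
sign-++ []          T = sym (*-identityˡ _)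
sign-++ (true  ∷ S) T = sign-++ S T
sign-++ (false ∷ S) T = trans (cong -_ (sign-++ S T)) (neg-distribˡ-* (sign S) (sign T))

sign-⊤ : ∀ n → sign (⊤ {n}) ≡ 1ℚ
sign-⊤ ℕ.zero  = refl
sign-⊤ (suc n) = sign-⊤ n

expand : ∀ {n} (S : Subset n) → Subset ∣ S ∣ → Subset n
expand []          []      = []
expand (true  ∷ S) (t ∷ T) = t ∷ expand S T
expand (false ∷ S) T       = false ∷ expand S T

∈-expand⁺ : ∀ {n} (S : Subset n) T i → i ∈ₛ T → embed S i ∈ₛ expand S T
∈-expand⁺ (true  ∷ S) (t ∷ T) zero    i∈T = i∈T
∈-expand⁺ (true  ∷ S) (t ∷ T) (suc i) i∈T = ∈-expand⁺ S T i i∈T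
∈-expand⁺ (false ∷ S) T       i       i∈T = ∈-expand⁺ S T i i∈T

∈-expand⁻ : ∀ {n} (S : Subset n) T j → j ∈ₛ expand S T →
            ∃ λ i → i ∈ₛ T × embed S i ≡ j
∈-expand⁻ (true  ∷ S) (t ∷ T) zero    j∈ = zero , j∈ , refl
∈-expand⁻ (true  ∷ S) (t ∷ T) (suc j) j∈ with i , i∈T , refl ← ∈-expand⁻ S T j j∈ = suc i , i∈T , refl
∈-expand⁻ (false ∷ S) T       (suc j) j∈ with i , i∈T , refl ← ∈-expand⁻ S T j j∈ = i , i∈T , refl

imageOn : ∀ {m n} → (Fin m → Fin n) → Subset m → Subset n
imageOn σ T = Vec.tabulate (λ j → does (Fin.any? (λ i → (Vec.lookup T i Bool.≟ true) ×-dec (σ i Fin.≟ j))))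

∈-imageOn⁺ : ∀ {m n} (σ : Fin m → Fin n) T {i j} → i ∈ₛ T → σ i ≡ j → j ∈ₛ imageOn σ T
∈-imageOn⁺ σ T {i} {j} i∈T σi≡j =
  trans (VP.lookup∘tabulate _ j) (dec-true (Fin.any? (λ i → (Vec.lookup T i Bool.≟ true) ×-dec (σ i Fin.≟ j))) (i , i∈T , σi≡j))

∈-imageOn⁻ : ∀ {m n} (σ : Fin m → Fin n) T j → j ∈ₛ imageOn σ T → ∃ λ i → i ∈ₛ T × σ i ≡ j
∈-imageOn⁻ σ T j j∈ =
  from-does (Fin.any? (λ i → (Vec.lookup T i Bool.≟ true) ×-dec (σ i Fin.≟ j))) (trans (sym (VP.lookup∘tabulate _ j)) j∈)

imageOn-inverse : ∀ {m n} (σ : Fin m → Fin n) (τ : Fin n → Fin m) → (∀ i → τ (σ i) ≡ i) →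
                  ∀ T → imageOn τ (imageOn σ T) ≡ T
imageOn-inverse σ τ τ∘σ≗id T = subset-ext
  (λ j j∈ → let i , i∈ , τi≡j = ∈-imageOn⁻ τ (imageOn σ T) j j∈
                i′ , i′∈T , σi′≡i = ∈-imageOn⁻ σ T i i∈
            in subst (_∈ₛ T) (trans (sym (τ∘σ≗id i′)) (trans (cong τ σi′≡i) τi≡j)) i′∈T)
  (λ j j∈T → ∈-imageOn⁺ τ (imageOn σ T) (∈-imageOn⁺ σ T j∈T refl) (τ∘σ≗id j))

imageOn-embed : ∀ {n} (S : Subset n) T → imageOn (embed S) T ≡ expand S T
imageOn-embed S T = subset-ext
  (λ j j∈ → let i , i∈T , embed-i≡j = ∈-imageOn⁻ (embed S) T j j∈ in subst (_∈ₛ expand S T) embed-i≡j (∈-expand⁺ S T i i∈T))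
  (λ j j∈ → let i , i∈T , embed-i≡j = ∈-expand⁻ S T j j∈ in ∈-imageOn⁺ (embed S) T i∈T embed-i≡j)

module _ (H : AssocPresheaf) where
  open AssocPresheaf H

  infixl 7 _⊗_ _•_
  infixr 7 _⊛_

  _⊗_ : Alg H → Alg H → Alg H
  _⊗_ = _·_ H

  _•_ : Obj H → Obj H → Obj H
  _•_ = _·o_ H

  _⊛_ : ℚ → Alg H → Alg H
  _⊛_ = _⊙_ H

  size : ℚ × Obj H → ℕ
  size = proj₁ ∘ proj₂

  lin-++ : ∀ φ x y → lin H φ (x ++ y) ≡ lin H φ x + lin H φ y
  lin-++ φ x y = ∑-++ x y (λ t → proj₁ t * φ (proj₂ t))

  lin-⊛ : ∀ φ c x → lin H φ (c ⊛ x) ≡ c * lin H φ x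
  lin-⊛ φ c x = begin
    lin H φ (c ⊛ x)                        ≡⟨ ∑-map _ x (λ t → proj₁ t * φ (proj₂ t)) ⟩
    ∑[ t ∈ x ] ((c * proj₁ t) * φ (proj₂ t)) ≡⟨ ∑-cong x (λ t → *-assoc c (proj₁ t) _) ⟩
    ∑[ t ∈ x ] (c * (proj₁ t * φ (proj₂ t))) ≡⟨ ∑-factorˡ x c (λ t → proj₁ t * φ (proj₂ t)) ⟩
    c * lin H φ x                          ∎
    where open ≡-Reasoning

  lin-cong : ∀ {φ ψ} x → (∀ o → φ o ≡ ψ o) → lin H φ x ≡ lin H ψ x
  lin-cong x φ≗ψ = ∑-cong x (λ t → cong (proj₁ t *_) (φ≗ψ (proj₂ t)))

  lin-⊗ : ∀ φ x y → lin H φ (x ⊗ y) ≡ lin H (λ o → lin H (λ o′ → φ (o • o′)) y) x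
  lin-⊗ φ x y = trans (∑-concatMap _ x (λ t → proj₁ t * φ (proj₂ t))) (∑-cong x λ s → begin
    ∑ (map (λ t → (proj₁ s * proj₁ t , proj₂ s • proj₂ t)) y) (λ t → proj₁ t * φ (proj₂ t))
      ≡⟨ ∑-map _ y (λ t → proj₁ t * φ (proj₂ t)) ⟩
    ∑[ t ∈ y ] ((proj₁ s * proj₁ t) * φ (proj₂ s • proj₂ t))
      ≡⟨ ∑-cong y (λ t → *-assoc (proj₁ s) (proj₁ t) _) ⟩
    ∑[ t ∈ y ] (proj₁ s * (proj₁ t * φ (proj₂ s • proj₂ t)))
      ≡⟨ ∑-factorˡ y (proj₁ s) (λ t → proj₁ t * φ (proj₂ s • proj₂ t)) ⟩
    proj₁ s * lin H (λ o′ → φ (proj₂ s • o′)) y ∎)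
    where open ≡-Reasoning

  lin-comm : ∀ (G : Obj H → Obj H → ℚ) x y →
             lin H (λ o → lin H (G o) y) x ≡ lin H (λ o′ → lin H (λ o → G o o′) x) y
  lin-comm G x y = begin
    ∑[ s ∈ x ] (proj₁ s * ∑[ t ∈ y ] (proj₁ t * G (proj₂ s) (proj₂ t)))
      ≡⟨ ∑-cong x (λ s → sym (∑-factorˡ y (proj₁ s) _)) ⟩
    ∑[ s ∈ x ] ∑[ t ∈ y ] (proj₁ s * (proj₁ t * G (proj₂ s) (proj₂ t)))
      ≡⟨ ∑-comm x y (λ s t → proj₁ s * (proj₁ t * G (proj₂ s) (proj₂ t))) ⟩
    ∑[ t ∈ y ] ∑[ s ∈ x ] (proj₁ s * (proj₁ t * G (proj₂ s) (proj₂ t)))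
      ≡⟨ ∑-cong y (λ t → ∑-cong x (λ s → solve 3 (λ a b g → a :* (b :* g) := b :* (a :* g)) refl (proj₁ s) (proj₁ t) _)) ⟩
    ∑[ t ∈ y ] ∑[ s ∈ x ] (proj₁ t * (proj₁ s * G (proj₂ s) (proj₂ t)))
      ≡⟨ ∑-cong y (λ t → ∑-factorˡ x (proj₁ t) _) ⟩
    ∑[ t ∈ y ] (proj₁ t * ∑[ s ∈ x ] (proj₁ s * G (proj₂ s) (proj₂ t))) ∎
    where open ≡-Reasoning

  lin-vanishing : ∀ {φ} w → All (λ t → φ (proj₂ t) ≡ 0ℚ) w → lin H φ w ≡ 0ℚ
  lin-vanishing []            []             = refl
  lin-vanishing ((c , o) ∷ w) (φo≡0 ∷ φw≡0) =
    trans (cong₂ _+_ (trans (cong (c *_) φo≡0) (*-zeroʳ c)) (lin-vanishing w φw≡0)) (+-identityʳ 0ℚ)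

  -- Wrapping _≈_ in a record lets Agda infer both sides from a proof of equivalence.
  infix 4 _≋_
  record _≋_ (x y : Alg H) : Set where
    constructor mk≋
    field lin-≡ : _≈_ H x y
  open _≋_

  ≋-refl : ∀ {x} → x ≋ x
  ≋-refl = mk≋ λ _ _ → refl

  ≋-sym : ∀ {x y} → x ≋ y → y ≋ x
  ≋-sym x≋y = mk≋ λ φ φ-inv → sym (lin-≡ x≋y φ φ-inv)

  ≋-trans : ∀ {x y z} → x ≋ y → y ≋ z → x ≋ z
  ≋-trans x≋y y≋z = mk≋ λ φ φ-inv → trans (lin-≡ x≋y φ φ-inv) (lin-≡ y≋z φ φ-inv)

  ++-cong : ∀ {x x′ y y′} → x ≋ x′ → y ≋ y′ → x ++ y ≋ x′ ++ y′
  ++-cong {x} {x′} {y} {y′} x≋x′ y≋y′ = mk≋ λ φ φ-inv →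
    trans (lin-++ φ x y) (trans (cong₂ _+_ (lin-≡ x≋x′ φ φ-inv) (lin-≡ y≋y′ φ φ-inv)) (sym (lin-++ φ x′ y′)))

  ⊛-cong : ∀ c {x x′} → x ≋ x′ → c ⊛ x ≋ c ⊛ x′
  ⊛-cong c {x} {x′} x≋x′ = mk≋ λ φ φ-inv →
    trans (lin-⊛ φ c x) (trans (cong (c *_) (lin-≡ x≋x′ φ φ-inv)) (sym (lin-⊛ φ c x′)))

  ++-interchange : ∀ a b c d → (a ++ b) ++ (c ++ d) ≋ (a ++ c) ++ (b ++ d)
  ++-interchange a b c d = mk≋ λ φ _ → begin
    lin H φ ((a ++ b) ++ (c ++ d))
      ≡⟨ trans (lin-++ φ (a ++ b) (c ++ d)) (cong₂ _+_ (lin-++ φ a b) (lin-++ φ c d)) ⟩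
    (lin H φ a + lin H φ b) + (lin H φ c + lin H φ d)
      ≡⟨ solve 4 (λ a b c d → (a :+ b) :+ (c :+ d) := (a :+ c) :+ (b :+ d)) refl
                 (lin H φ a) (lin H φ b) (lin H φ c) (lin H φ d) ⟩
    (lin H φ a + lin H φ c) + (lin H φ b + lin H φ d)
      ≡⟨ sym (trans (lin-++ φ (a ++ c) (b ++ d)) (cong₂ _+_ (lin-++ φ a c) (lin-++ φ b d))) ⟩
    lin H φ ((a ++ c) ++ (b ++ d)) ∎
    where open ≡-Reasoning

  invariant-•ˡ : ∀ {φ} → Invariant H φ → ∀ a → Invariant H (λ o → φ (a • o))
  invariant-•ˡ {φ} φ-inv (n , x) m σ σ-inj b = begin
    φ (n +ℕ m , x ∗ res σ σ-inj b)
      ≡⟨ cong (λ z → φ (n +ℕ m , z ∗ res σ σ-inj b)) (sym (res-id id-injective x)) ⟩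
    φ (n +ℕ m , res id id-injective x ∗ res σ σ-inj b)
      ≡⟨ cong (λ z → φ (n +ℕ m , z)) (sym (res-∗ id σ id-injective σ-inj id⊕σ-inj x b)) ⟩
    φ (n +ℕ m , res (id ⊕ σ) id⊕σ-inj (x ∗ b))
      ≡⟨ φ-inv (n +ℕ m) (id ⊕ σ) id⊕σ-inj (x ∗ b) ⟩
    φ (n +ℕ m , x ∗ b) ∎
    where
    open ≡-Reasoning
    id⊕σ-inj = ⊕-injective id-injective σ-inj

  invariant-•ʳ : ∀ {φ} → Invariant H φ → ∀ a → Invariant H (λ o → φ (o • a))
  invariant-•ʳ {φ} φ-inv (n , x) m σ σ-inj b = begin
    φ (m +ℕ n , res σ σ-inj b ∗ x)
      ≡⟨ cong (λ z → φ (m +ℕ n , res σ σ-inj b ∗ z)) (sym (res-id id-injective x)) ⟩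
    φ (m +ℕ n , res σ σ-inj b ∗ res id id-injective x)
      ≡⟨ cong (λ z → φ (m +ℕ n , z)) (sym (res-∗ σ id σ-inj id-injective σ⊕id-inj b x)) ⟩
    φ (m +ℕ n , res (σ ⊕ id) σ⊕id-inj (b ∗ x))
      ≡⟨ φ-inv (m +ℕ n) (σ ⊕ id) σ⊕id-inj (b ∗ x) ⟩
    φ (m +ℕ n , b ∗ x) ∎
    where
    open ≡-Reasoning
    σ⊕id-inj = ⊕-injective σ-inj id-injective

  ⊗-congˡ : ∀ y {x x′} → x ≋ x′ → y ⊗ x ≋ y ⊗ x′
  ⊗-congˡ y {x} {x′} x≋x′ = mk≋ λ φ φ-inv → begin
    lin H φ (y ⊗ x)                                 ≡⟨ lin-⊗ φ y x ⟩
    lin H (λ o → lin H (λ o′ → φ (o • o′)) x) y     ≡⟨ lin-cong y (λ o → lin-≡ x≋x′ _ (invariant-•ˡ φ-inv o)) ⟩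
    lin H (λ o → lin H (λ o′ → φ (o • o′)) x′) y    ≡⟨ sym (lin-⊗ φ y x′) ⟩
    lin H φ (y ⊗ x′)                                ∎
    where open ≡-Reasoning

  ⊗-congʳ : ∀ y {x x′} → x ≋ x′ → x ⊗ y ≋ x′ ⊗ y
  ⊗-congʳ y {x} {x′} x≋x′ = mk≋ λ φ φ-inv → begin
    lin H φ (x ⊗ y)                                 ≡⟨ lin-⊗ φ x y ⟩
    lin H (λ o → lin H (λ o′ → φ (o • o′)) y) x     ≡⟨ lin-comm (λ o o′ → φ (o • o′)) x y ⟩
    lin H (λ o′ → lin H (λ o → φ (o • o′)) x) y     ≡⟨ lin-cong y (λ o′ → lin-≡ x≋x′ _ (invariant-•ʳ φ-inv o′)) ⟩
    lin H (λ o′ → lin H (λ o → φ (o • o′)) x′) y    ≡⟨ sym (lin-comm (λ o o′ → φ (o • o′)) x′ y) ⟩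
    lin H (λ o → lin H (λ o′ → φ (o • o′)) y) x′    ≡⟨ sym (lin-⊗ φ x′ y) ⟩
    lin H φ (x′ ⊗ y)                                ∎
    where open ≡-Reasoning

  -- The Möbius transform

  restrict : ∀ {n} → h n → Subset n → Obj H
  restrict b S = ∣ S ∣ , res (embed S) (embed-injective S) b

  res-≡-cast : ∀ {k k′ n} (eq : k ≡ k′) (f : Fin k → Fin n) (g : Fin k′ → Fin n) (f-inj : Inj f) (g-inj : Inj g) →
               (∀ i → f i ≡ g (cast eq i)) → (b : h n) → _≡_ {A = Obj H} (k , res f f-inj b) (k′ , res g g-inj b)
  res-≡-cast {k} refl f g f-inj g-inj f≗g b =
    cong (k ,_) (res-irr f g f-inj g-inj (λ i → trans (f≗g i) (cong g (Fin.cast-is-id refl i))) b)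

  restrict-++ : ∀ {n m} (S : Subset n) (T : Subset m) (a : h n) (b : h m) →
                restrict (a ∗ b) (S Vec.++ T) ≡ restrict a S • restrict b T
  restrict-++ S T a b = trans
    (res-≡-cast (∣S++T∣≡∣S∣+∣T∣ S T) (embed (S Vec.++ T)) (embed S ⊕ embed T) (embed-injective _) S⊕T-inj
                (embed-++ S T) (a ∗ b))
    (cong (∣ S ∣ +ℕ ∣ T ∣ ,_) (res-∗ (embed S) (embed T) (embed-injective S) (embed-injective T) S⊕T-inj a b))
    where S⊕T-inj = ⊕-injective (embed-injective S) (embed-injective T)

  restrict-⊤ : ∀ {n} (b : h n) → restrict b ⊤ ≡ (n , b)
  restrict-⊤ {n} b = trans (res-≡-cast (∣⊤∣≡n n) (embed ⊤) id (embed-injective _) id-injective (embed-⊤ n) b)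
                           (cong (n ,_) (res-id id-injective b))

  𝒫 : ∀ n → List (Subset n)
  𝒫 = allSubsets H

  ∑-𝒫-suc : ∀ n F → ∑ (𝒫 (suc n)) F ≡ ∑[ S ∈ 𝒫 n ] (F (true ∷ S) + F (false ∷ S))
  ∑-𝒫-suc n F = trans (∑-concatMap _ (𝒫 n) F) (∑-cong (𝒫 n) (λ S → cong (F (true ∷ S) +_) (+-identityʳ _)))

  ∑-𝒫-++ : ∀ n m F → ∑ (𝒫 (n +ℕ m)) F ≡ ∑[ S ∈ 𝒫 n ] ∑[ T ∈ 𝒫 m ] F (S Vec.++ T)
  ∑-𝒫-++ ℕ.zero  m F = sym (+-identityʳ _)
  ∑-𝒫-++ (suc n) m F = begin
    ∑ (𝒫 (suc n +ℕ m)) F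
      ≡⟨ ∑-𝒫-suc (n +ℕ m) F ⟩
    ∑[ U ∈ 𝒫 (n +ℕ m) ] (F (true ∷ U) + F (false ∷ U))
      ≡⟨ ∑-𝒫-++ n m (λ U → F (true ∷ U) + F (false ∷ U)) ⟩
    ∑[ S ∈ 𝒫 n ] ∑[ T ∈ 𝒫 m ] (F (true ∷ S Vec.++ T) + F (false ∷ S Vec.++ T))
      ≡⟨ ∑-cong (𝒫 n) (λ S → ∑-distrib-+ (𝒫 m) (λ T → F (true ∷ S Vec.++ T)) (λ T → F (false ∷ S Vec.++ T))) ⟩
    ∑[ S ∈ 𝒫 n ] (∑[ T ∈ 𝒫 m ] F (true ∷ S Vec.++ T) + ∑[ T ∈ 𝒫 m ] F (false ∷ S Vec.++ T))
      ≡⟨ sym (∑-𝒫-suc n (λ S → ∑[ T ∈ 𝒫 m ] F (S Vec.++ T))) ⟩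
    ∑[ S ∈ 𝒫 (suc n) ] ∑[ T ∈ 𝒫 m ] F (S Vec.++ T) ∎
    where open ≡-Reasoning

  möbius : Obj H → Alg H
  möbius (n , b) = map (λ S → sign S , restrict b S) (𝒫 n)

  möbiusAlg : Alg H → Alg H
  möbiusAlg w = concatMap (λ t → proj₁ t ⊛ möbius (proj₂ t)) w

  lin-möbius : ∀ φ n (b : h n) → lin H φ (möbius (n , b)) ≡ ∑[ S ∈ 𝒫 n ] (sign S * φ (restrict b S))
  lin-möbius φ n b = ∑-map _ (𝒫 n) (λ t → proj₁ t * φ (proj₂ t))

  lin-möbiusAlg : ∀ φ w → lin H φ (möbiusAlg w) ≡ lin H (λ o → lin H φ (möbius o)) w
  lin-möbiusAlg φ w = trans (∑-concatMap _ w (λ t → proj₁ t * φ (proj₂ t)))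
                            (∑-cong w (λ t → lin-⊛ φ (proj₁ t) (möbius (proj₂ t))))

  lin-low+möbius : ∀ φ y w → lin H φ (y ++ möbiusAlg w) ≡ lin H φ y + lin H (λ o → lin H φ (möbius o)) w
  lin-low+möbius φ y w = trans (lin-++ φ y (möbiusAlg w)) (cong (lin H φ y +_) (lin-möbiusAlg φ w))

  lin-möbius-• : ∀ φ o₁ o₂ → lin H φ (möbius (o₁ • o₂)) ≡ lin H φ (möbius o₁ ⊗ möbius o₂)
  lin-möbius-• φ (n , a) (m , b) = begin
    lin H φ (möbius (n +ℕ m , a ∗ b))
      ≡⟨ lin-möbius φ (n +ℕ m) (a ∗ b) ⟩
    ∑[ U ∈ 𝒫 (n +ℕ m) ] (sign U * φ (restrict (a ∗ b) U))
      ≡⟨ ∑-𝒫-++ n m (λ U → sign U * φ (restrict (a ∗ b) U)) ⟩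
    ∑[ S ∈ 𝒫 n ] ∑[ T ∈ 𝒫 m ] (sign (S Vec.++ T) * φ (restrict (a ∗ b) (S Vec.++ T)))
      ≡⟨ ∑-cong (𝒫 n) (λ S → ∑-cong (𝒫 m) (λ T → split S T)) ⟩
    ∑[ S ∈ 𝒫 n ] ∑[ T ∈ 𝒫 m ] (sign S * (sign T * φ (restrict a S • restrict b T)))
      ≡⟨ ∑-cong (𝒫 n) (λ S → ∑-factorˡ (𝒫 m) (sign S) (λ T → sign T * φ (restrict a S • restrict b T))) ⟩
    ∑[ S ∈ 𝒫 n ] (sign S * ∑[ T ∈ 𝒫 m ] (sign T * φ (restrict a S • restrict b T)))
      ≡⟨ ∑-cong (𝒫 n) (λ S → cong (sign S *_) (sym (lin-möbius (λ o′ → φ (restrict a S • o′)) m b))) ⟩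
    ∑[ S ∈ 𝒫 n ] (sign S * lin H (λ o′ → φ (restrict a S • o′)) (möbius (m , b)))
      ≡⟨ sym (lin-möbius (λ o → lin H (λ o′ → φ (o • o′)) (möbius (m , b))) n a) ⟩
    lin H (λ o → lin H (λ o′ → φ (o • o′)) (möbius (m , b))) (möbius (n , a))
      ≡⟨ sym (lin-⊗ φ (möbius (n , a)) (möbius (m , b))) ⟩
    lin H φ (möbius (n , a) ⊗ möbius (m , b)) ∎
    where
    open ≡-Reasoning
    split : ∀ S T → sign (S Vec.++ T) * φ (restrict (a ∗ b) (S Vec.++ T))
                    ≡ sign S * (sign T * φ (restrict a S • restrict b T))
    split S T = trans (cong₂ _*_ (sign-++ S T) (cong φ (restrict-++ S T a b))) (*-assoc (sign S) (sign T) _)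

  möbiusAlg-⊗ : ∀ u w → möbiusAlg u ⊗ möbiusAlg w ≋ möbiusAlg (u ⊗ w)
  möbiusAlg-⊗ u w = mk≋ λ φ _ → begin
    lin H φ (möbiusAlg u ⊗ möbiusAlg w)
      ≡⟨ lin-⊗ φ (möbiusAlg u) (möbiusAlg w) ⟩
    lin H (λ o → lin H (λ o′ → φ (o • o′)) (möbiusAlg w)) (möbiusAlg u)
      ≡⟨ lin-möbiusAlg _ u ⟩
    lin H (λ o₁ → lin H (λ o → lin H (λ o′ → φ (o • o′)) (möbiusAlg w)) (möbius o₁)) u
      ≡⟨ lin-cong u (λ o₁ → lin-cong (möbius o₁) (λ o → lin-möbiusAlg (λ o′ → φ (o • o′)) w)) ⟩
    lin H (λ o₁ → lin H (λ o → lin H (λ o₂ → lin H (λ o′ → φ (o • o′)) (möbius o₂)) w) (möbius o₁)) u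
      ≡⟨ lin-cong u (λ o₁ → lin-comm (λ o o₂ → lin H (λ o′ → φ (o • o′)) (möbius o₂)) (möbius o₁) w) ⟩
    lin H (λ o₁ → lin H (λ o₂ → lin H (λ o → lin H (λ o′ → φ (o • o′)) (möbius o₂)) (möbius o₁)) w) u
      ≡⟨ lin-cong u (λ o₁ → lin-cong w (λ o₂ →
           sym (trans (lin-möbius-• φ o₁ o₂) (lin-⊗ φ (möbius o₁) (möbius o₂))))) ⟩
    lin H (λ o₁ → lin H (λ o₂ → lin H φ (möbius (o₁ • o₂))) w) u
      ≡⟨ sym (lin-⊗ (λ o → lin H φ (möbius o)) u w) ⟩
    lin H (λ o → lin H φ (möbius o)) (u ⊗ w)
      ≡⟨ sym (lin-möbiusAlg φ (u ⊗ w)) ⟩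
    lin H φ (möbiusAlg (u ⊗ w)) ∎
    where open ≡-Reasoning

  möbiusAlg-++ : ∀ w w′ → möbiusAlg (w ++ w′) ≡ möbiusAlg w ++ möbiusAlg w′
  möbiusAlg-++ = List.concatMap-++ _

  möbiusAlg-⊛ : ∀ c w → möbiusAlg (c ⊛ w) ≋ c ⊛ möbiusAlg w
  möbiusAlg-⊛ c w = mk≋ λ φ _ → begin
    lin H φ (möbiusAlg (c ⊛ w))                 ≡⟨ lin-möbiusAlg φ (c ⊛ w) ⟩
    lin H (λ o → lin H φ (möbius o)) (c ⊛ w)    ≡⟨ lin-⊛ _ c w ⟩
    c * lin H (λ o → lin H φ (möbius o)) w      ≡⟨ cong (c *_) (sym (lin-möbiusAlg φ w)) ⟩
    c * lin H φ (möbiusAlg w)                   ≡⟨ sym (lin-⊛ φ c (möbiusAlg w)) ⟩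
    lin H φ (c ⊛ möbiusAlg w)                   ∎
    where open ≡-Reasoning

  -- Triangularity and the ideal J_K

  𝒫≡⊤∷smaller : ∀ n → ∃ λ R → 𝒫 n ≡ ⊤ ∷ R × All (λ S → ∣ S ∣ < n) R
  𝒫≡⊤∷smaller ℕ.zero  = [] , refl , []
  𝒫≡⊤∷smaller (suc n) with R , 𝒫n≡⊤∷R , R-smaller ← 𝒫≡⊤∷smaller n =
    (false ∷ ⊤) ∷ concatMap extend R , cong (concatMap extend) 𝒫n≡⊤∷R ,
    subst (_< suc n) (sym (∣⊤∣≡n n)) (ℕ.n<1+n n) ∷ AllP.concat⁺ (AllP.map⁺ (All.map extend-smaller R-smaller))
    where
    extend : Subset n → List (Subset (suc n))
    extend S = (true ∷ S) ∷ (false ∷ S) ∷ []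
    extend-smaller : ∀ {S} → ∣ S ∣ < n → All (λ S′ → ∣ S′ ∣ < suc n) (extend S)
    extend-smaller S<n = s≤s S<n ∷ ℕ.m<n⇒m<1+n S<n ∷ []

  object≋möbius-smaller : ∀ n (b : h n) {R} → 𝒫 n ≡ ⊤ ∷ R →
    [ (1ℚ , (n , b)) ] ≋ möbiusAlg [ (1ℚ , (n , b)) ] ++ (- 1ℚ) ⊛ map (λ S → sign S , restrict b S) R
  object≋möbius-smaller n b {R} 𝒫n≡⊤∷R = mk≋ λ φ _ → begin
    1ℚ * φ (n , b) + 0ℚ
      ≡⟨ solve 2 (λ a r → con 1ℚ :* a :+ con 0ℚ := (con 1ℚ :* (a :+ r) :+ con 0ℚ) :+ (:- con 1ℚ) :* r) refl
                 (φ (n , b)) (lin H φ rest) ⟩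
    (1ℚ * (φ (n , b) + lin H φ rest) + 0ℚ) + (- 1ℚ) * lin H φ rest
      ≡⟨ cong₂ _+_ (cong (λ z → 1ℚ * z + 0ℚ) (sym (leading φ))) (sym (lin-⊛ φ (- 1ℚ) rest)) ⟩
    lin H (λ o → lin H φ (möbius o)) [ (1ℚ , (n , b)) ] + lin H φ ((- 1ℚ) ⊛ rest)
      ≡⟨ cong (_+ lin H φ ((- 1ℚ) ⊛ rest)) (sym (lin-möbiusAlg φ [ (1ℚ , (n , b)) ])) ⟩
    lin H φ (möbiusAlg [ (1ℚ , (n , b)) ]) + lin H φ ((- 1ℚ) ⊛ rest)
      ≡⟨ sym (lin-++ φ (möbiusAlg [ (1ℚ , (n , b)) ]) ((- 1ℚ) ⊛ rest)) ⟩
    lin H φ (möbiusAlg [ (1ℚ , (n , b)) ] ++ (- 1ℚ) ⊛ rest) ∎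
    where
    open ≡-Reasoning
    rest : Alg H
    rest = map (λ S → sign S , restrict b S) R
    leading : ∀ φ → lin H φ (möbius (n , b)) ≡ φ (n , b) + lin H φ rest
    leading φ = trans (cong (λ Ss → lin H φ (map (λ S → sign S , restrict b S) Ss)) 𝒫n≡⊤∷R)
                      (cong (_+ lin H φ rest)
                            (trans (cong₂ _*_ (sign-⊤ n) (cong φ (restrict-⊤ b))) (*-identityˡ (φ (n , b)))))

  record Decomposition (P : ℕ → Set) (x : Alg H) : Set where
    constructor decomposition
    field
      low         : Alg H
      high        : Alg H
      low-P       : All (P ∘ size) low
      high-¬P     : All (¬_ ∘ P ∘ size) high
      x≋low+high  : x ≋ low ++ möbiusAlg high

  module _ {P : ℕ → Set} where

    decomposition-resp : ∀ {x x′} → x ≋ x′ → Decomposition P x → Decomposition P x′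
    decomposition-resp x≋x′ (decomposition y w y-P w-¬P x≋) = decomposition y w y-P w-¬P (≋-trans (≋-sym x≋x′) x≋)

    decomposition-++ : ∀ {x x′} → Decomposition P x → Decomposition P x′ → Decomposition P (x ++ x′)
    decomposition-++ (decomposition y w y-P w-¬P x≋) (decomposition y′ w′ y′-P w′-¬P x′≋) =
      decomposition (y ++ y′) (w ++ w′) (AllP.++⁺ y-P y′-P) (AllP.++⁺ w-¬P w′-¬P)
        (≋-trans (++-cong x≋ x′≋) (subst (λ z → (y ++ möbiusAlg w) ++ (y′ ++ möbiusAlg w′) ≋ (y ++ y′) ++ z)
                                          (sym (möbiusAlg-++ w w′)) (++-interchange y (möbiusAlg w) y′ (möbiusAlg w′))))

    decomposition-⊛ : ∀ c {x} → Decomposition P x → Decomposition P (c ⊛ x)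
    decomposition-⊛ c (decomposition y w y-P w-¬P x≋) =
      decomposition (c ⊛ y) (c ⊛ w) (AllP.map⁺ y-P) (AllP.map⁺ w-¬P)
        (≋-trans (⊛-cong c x≋) (subst (_≋ c ⊛ y ++ möbiusAlg (c ⊛ w)) (sym (List.map-++ _ y (möbiusAlg w)))
                                      (++-cong ≋-refl (≋-sym (möbiusAlg-⊛ c w)))))

    decomposition-of-objects : ∀ x → All (λ t → Decomposition P [ (1ℚ , proj₂ t) ]) x → Decomposition P x
    decomposition-of-objects []            []       = decomposition [] [] [] [] ≋-refl
    decomposition-of-objects ((c , o) ∷ x) (dₒ ∷ ds) =
      decomposition-++ {[ (c , o) ]} (decomposition-resp c·1≋c (decomposition-⊛ c dₒ)) (decomposition-of-objects x ds)
      where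
      c·1≋c : c ⊛ [ (1ℚ , o) ] ≋ [ (c , o) ]
      c·1≋c = mk≋ λ φ _ → cong (λ z → z * φ o + 0ℚ) (*-identityʳ c)

    decompose : (∀ n → Dec (P n)) → ∀ x → Decomposition P x
    decompose P? x = decomposition-of-objects x (All.tabulate (λ {t} _ → decompose-object (size t) (proj₂ (proj₂ t))))
      where
      decompose-object : ∀ n (b : h n) → Decomposition P [ (1ℚ , (n , b)) ]
      decompose-object = <-rec _ step
        where
        step : ∀ n → (∀ {m} → m < n → ∀ (b : h m) → Decomposition P [ (1ℚ , (m , b)) ]) →
               ∀ (b : h n) → Decomposition P [ (1ℚ , (n , b)) ]
        step n rec b with P? n | 𝒫≡⊤∷smaller n
        ... | yes Pn | _ = decomposition [ (1ℚ , (n , b)) ] [] (Pn ∷ []) [] ≋-refl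
        ... | no ¬Pn | R , 𝒫n≡⊤∷R , R-smaller =
          decomposition-resp (≋-sym (object≋möbius-smaller n b 𝒫n≡⊤∷R))
            (decomposition-++ (decomposition [] [ (1ℚ , (n , b)) ] [] (¬Pn ∷ []) ≋-refl)
                              (decomposition-⊛ (- 1ℚ) (decomposition-of-objects _
                                 (AllP.map⁺ (All.map (λ S<n → rec S<n _) R-smaller)))))

  spanned-by-möbius : ∀ x → ∃ λ v → x ≋ möbiusAlg v
  spanned-by-möbius x = without-low (decompose (λ _ → no id) x)
    where
    without-low : ∀ {x} → Decomposition (λ _ → ⊥) x → ∃ λ v → x ≋ möbiusAlg v
    without-low (decomposition []      v []       _ x≋) = v , x≋
    without-low (decomposition (_ ∷ _) _ (() ∷ _) _ _)

  Ideal : ℕ → Alg H → Set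
  Ideal K x = ∃ λ w → All (λ t → K < size t) w × x ≋ möbiusAlg w

  module _ {K : ℕ} where

    large-⊗ˡ : ∀ v w → All (λ t → K < size t) w → All (λ t → K < size t) (v ⊗ w)
    large-⊗ˡ v w w-large = AllP.concat⁺ (AllP.map⁺ (go v))
      where
      go : ∀ v′ → All (λ s → All (λ t → K < size t) (map (λ t → proj₁ s * proj₁ t , proj₂ s • proj₂ t) w)) v′
      go []       = []
      go (s ∷ v′) = AllP.map⁺ (All.map (λ {t} K<t → ℕ.<-≤-trans K<t (ℕ.m≤n+m (size t) (size s))) w-large) ∷ go v′

    large-⊗ʳ : ∀ w v → All (λ t → K < size t) w → All (λ t → K < size t) (w ⊗ v)
    large-⊗ʳ w v w-large = AllP.concat⁺ (AllP.map⁺ (All.map (λ {s} K<s → AllP.map⁺ (go s K<s v)) w-large))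
      where
      go : ∀ s → K < size s → ∀ v′ → All (λ t → K < size (proj₁ s * proj₁ t , proj₂ s • proj₂ t)) v′
      go s K<s []       = []
      go s K<s (t ∷ v′) = ℕ.<-≤-trans K<s (ℕ.m≤m+n (size s) (size t)) ∷ go s K<s v′

    ideal-isIdeal : IsIdeal H (Ideal K)
    ideal-isIdeal = record
      { resp  = λ x y x≈y (w , w-large , x≋) → w , w-large , ≋-trans (≋-sym (mk≋ x≈y)) x≋
      ; zero∈ = [] , [] , ≋-refl
      ; ⊞∈    = λ x y (w , w-large , x≋) (w′ , w′-large , y≋) →
                  w ++ w′ , AllP.++⁺ w-large w′-large , subst (x ++ y ≋_) (sym (möbiusAlg-++ w w′)) (++-cong x≋ y≋)
      ; ⊙∈    = λ c x (w , w-large , x≋) → c ⊛ w , AllP.map⁺ w-large , ≋-trans (⊛-cong c x≋) (≋-sym (möbiusAlg-⊛ c w))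
      ; ·ˡ∈   = λ y x (w , w-large , x≋) → let v , y≋ = spanned-by-möbius y in
                  v ⊗ w , large-⊗ˡ v w w-large , ≋-trans (⊗-congʳ x y≋) (≋-trans (⊗-congˡ (möbiusAlg v) x≋) (möbiusAlg-⊗ v w))
      ; ·ʳ∈   = λ x y (w , w-large , x≋) → let v , y≋ = spanned-by-möbius y in
                  w ⊗ v , large-⊗ʳ w v w-large , ≋-trans (⊗-congˡ x y≋) (≋-trans (⊗-congʳ (möbiusAlg v) x≋) (möbiusAlg-⊗ w v))
      }

    objectsOfSize : ℕ → List (Obj H)
    objectsOfSize n = map (λ j → n , Inverse.to (proj₂ (finite n)) j) (allFin (proj₁ (finite n)))

    smallObjects : List (Obj H)
    smallObjects = concatMap objectsOfSize (upTo (suc K))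

    ∈-smallObjects : ∀ o → proj₁ o ≤ K → o ∈ smallObjects
    ∈-smallObjects (n , b) n≤K = ∈-concat⁺′ (∈-objectsOfSize b) (∈-map⁺ objectsOfSize (∈-upTo⁺ (s≤s n≤K)))
      where
      ∈-objectsOfSize : ∀ b → (n , b) ∈ objectsOfSize n
      ∈-objectsOfSize b = subst (λ b′ → (n , b′) ∈ objectsOfSize n) (Inverse.strictlyInverseˡ (proj₂ (finite n)) b)
                                (∈-map⁺ (λ j → n , Inverse.to (proj₂ (finite n)) j) (∈-allFin (Inverse.from (proj₂ (finite n)) b)))

    basis : Fin (length smallObjects) → Alg H
    basis i = [ (1ℚ , lookup smallObjects i) ]

    span : (Fin (length smallObjects) → ℚ) → Alg H
    span c = foldr (λ i r → (c i ⊛ basis i) ++ r) [] (allFin (length smallObjects))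

    lin-span : ∀ φ c → lin H φ (span c) ≡ ∑[ i ∈ allFin (length smallObjects) ] (c i * φ (lookup smallObjects i))
    lin-span φ c = go (allFin (length smallObjects))
      where
      go : ∀ is → lin H φ (foldr (λ i r → (c i ⊛ basis i) ++ r) [] is) ≡ ∑[ i ∈ is ] (c i * φ (lookup smallObjects i))
      go []       = refl
      go (i ∷ is) = trans (lin-++ φ (c i ⊛ basis i) (foldr (λ i r → (c i ⊛ basis i) ++ r) [] is))
                          (cong₂ _+_ (trans (+-identityʳ ((c i * 1ℚ) * φ (lookup smallObjects i)))
                                            (cong (_* φ (lookup smallObjects i)) (*-identityʳ (c i))))
                                     (go is))

    coordinates : ∀ y → All (λ t → size t ≤ K) y → Fin (length smallObjects) → ℚ
    coordinates []            []          i = 0ℚ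
    coordinates ((c , o) ∷ y) (o≤K ∷ y≤K) i = δ (index (∈-smallObjects o o≤K)) i * c + coordinates y y≤K i

    lin-coordinates : ∀ φ y y≤K → lin H φ y ≡ lin H φ (span (coordinates y y≤K))
    lin-coordinates φ y y≤K = trans (go y y≤K) (sym (lin-span φ (coordinates y y≤K)))
      where
      SO : List (Obj H)
      SO = smallObjects
      go : ∀ y y≤K → lin H φ y ≡ ∑[ i ∈ allFin (length SO) ] (coordinates y y≤K i * φ (lookup SO i))
      go []            []          =
        sym (trans (∑-cong (allFin (length SO)) (λ i → *-zeroˡ (φ (lookup SO i)))) (∑-zero (allFin (length SO))))
      go ((c , o) ∷ y) (o≤K ∷ y≤K) = sym (begin
        ∑[ i ∈ allFin (length SO) ] ((δ j i * c + coordinates y y≤K i) * φ (lookup SO i))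
          ≡⟨ ∑-cong (allFin (length SO)) (λ i → *-distribʳ-+ (φ (lookup SO i)) (δ j i * c) (coordinates y y≤K i)) ⟩
        ∑[ i ∈ allFin (length SO) ] (δ j i * c * φ (lookup SO i) + coordinates y y≤K i * φ (lookup SO i))
          ≡⟨ ∑-distrib-+ (allFin (length SO)) (λ i → δ j i * c * φ (lookup SO i))
                                              (λ i → coordinates y y≤K i * φ (lookup SO i)) ⟩
        ∑[ i ∈ allFin (length SO) ] (δ j i * c * φ (lookup SO i))
          + ∑[ i ∈ allFin (length SO) ] (coordinates y y≤K i * φ (lookup SO i))
          ≡⟨ cong₂ _+_ (trans (∑-cong (allFin (length SO)) (λ i → *-assoc (δ j i) c (φ (lookup SO i))))
                              (∑-allFin-δ (length SO) j (λ i → c * φ (lookup SO i))))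
                       (sym (go y y≤K)) ⟩
        c * φ (lookup SO j) + lin H φ y
          ≡⟨ cong (λ o′ → c * φ o′ + lin H φ y) (sym (lookup-index (∈-smallObjects o o≤K))) ⟩
        c * φ o + lin H φ y ∎)
        where
        open ≡-Reasoning
        j : Fin (length SO)
        j = index (∈-smallObjects o o≤K)

    ideal-finCodim : FinCodim H (Ideal K)
    ideal-finCodim = length smallObjects , basis , λ x →
      let decomposition y w y≤K w≰K x≋ = decompose (λ n → n ℕ.≤? K) x in
      coordinates y y≤K , w , All.map ℕ.≰⇒> w≰K , mk≋ λ φ φ-inv → begin
        lin H φ (x ++ (- 1ℚ) ⊛ span (coordinates y y≤K))
          ≡⟨ lin-++ φ x ((- 1ℚ) ⊛ span (coordinates y y≤K)) ⟩
        lin H φ x + lin H φ ((- 1ℚ) ⊛ span (coordinates y y≤K))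
          ≡⟨ cong₂ _+_ (trans (lin-≡ x≋ φ φ-inv) (lin-low+möbius φ y w))
                       (trans (lin-⊛ φ (- 1ℚ) (span (coordinates y y≤K)))
                              (cong ((- 1ℚ) *_) (sym (lin-coordinates φ y y≤K)))) ⟩
        (lin H φ y + lin H (λ o → lin H φ (möbius o)) w) + (- 1ℚ) * lin H φ y
          ≡⟨ solve 2 (λ a b → (a :+ b) :+ (:- con 1ℚ) :* a := b) refl
                     (lin H φ y) (lin H (λ o → lin H φ (möbius o)) w) ⟩
        lin H (λ o → lin H φ (möbius o)) w
          ≡⟨ sym (lin-möbiusAlg φ w) ⟩
        lin H φ (möbiusAlg w) ∎
      where open ≡-Reasoning

  -- Counting occurrences

  ∈-image⁻ : ∀ {k m} (ι : Fin k → Fin m) j → j ∈ₛ image H ι → ∃ λ i → ι i ≡ j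
  ∈-image⁻ ι j j∈ = from-does (Fin.any? (λ i → ι i Fin.≟ j)) (trans (sym (VP.lookup∘tabulate _ j)) j∈)

  ∈-image⁺ : ∀ {k m} (ι : Fin k → Fin m) i → ι i ∈ₛ image H ι
  ∈-image⁺ ι i = trans (VP.lookup∘tabulate _ (ι i)) (dec-true (Fin.any? (λ i′ → ι i′ Fin.≟ ι i)) (i , refl))

  image-cong : ∀ {k m} {f g : Fin k → Fin m} → (∀ i → f i ≡ g i) → image H f ≡ image H g
  image-cong {f = f} {g} f≗g = subset-ext
    (λ j j∈ → let i , fi≡j = ∈-image⁻ f j j∈ in subst (_∈ₛ image H g) (trans (sym (f≗g i)) fi≡j) (∈-image⁺ g i))
    (λ j j∈ → let i , gi≡j = ∈-image⁻ g j j∈ in subst (_∈ₛ image H f) (trans (f≗g i) gi≡j) (∈-image⁺ f i))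

  isOccurrence : ∀ {k m} → h k → h m → Subset m → Bool
  isOccurrence {k} {m} a c T = any (check H a c T) (allFuns H k m)

  record Occurrence {k m} (a : h k) (c : h m) (T : Subset m) : Set where
    constructor occurrence
    field
      ι           : Fin k → Fin m
      ι-injective : Inj ι
      image-ι     : image H ι ≡ T
      res-ι       : res ι ι-injective c ≡ a

  check-sound : ∀ {k m} (a : h k) (c : h m) T ι → check H a c T ι ≡ true → Occurrence a c T
  check-sound a c T ι checked with inj? H ι
  ... | yes ι-inj = occurrence ι (λ {i} {j} → ι-inj i j)
                      (from-does (VP.≡-dec Bool._≟_ (image H ι) T) (Bool.∧-conicalˡ _ _ checked))
                      (from-does (_≟h_ H (res ι (λ {i} {j} → ι-inj i j) c) a) (Bool.∧-conicalʳ _ _ checked))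

  check-complete : ∀ {k m} (a : h k) (c : h m) T ι (ι-inj : Inj ι) → image H ι ≡ T → res ι ι-inj c ≡ a →
                   check H a c T ι ≡ true
  check-complete a c T ι ι-inj image≡T res≡a with inj? H ι
  ... | no ¬ι-inj = ⊥-elim (¬ι-inj (λ i j → ι-inj))
  ... | yes _     = cong₂ _∧_ (dec-true (VP.≡-dec Bool._≟_ (image H ι) T) image≡T)
                              (dec-true (_≟h_ H _ a) (trans (res-irr ι ι _ ι-inj (λ _ → refl) c) res≡a))

  allFuns-complete : ∀ k m (f : Fin k → Fin m) → Any (λ g → ∀ i → g i ≡ f i) (allFuns H k m)
  allFuns-complete ℕ.zero  m f = here (λ ())
  allFuns-complete (suc k) m f = AnyP.concat⁺ (AnyP.map⁺ (Any.map
    (λ {g} g≗f∘suc → AnyP.map⁺ (Any.map (λ {j} j≡f0 → λ { zero → sym j≡f0 ; (suc i) → g≗f∘suc i }) (∈-allFin (f zero))))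
    (allFuns-complete k m (f ∘ suc))))

  isOccurrence-sound : ∀ {k m} (a : h k) (c : h m) T → isOccurrence a c T ≡ true → Occurrence a c T
  isOccurrence-sound {k} {m} a c T found =
    let ι , checked = Any.satisfied (any≡true⇒Any (check H a c T) (allFuns H k m) found) in check-sound a c T ι checked

  isOccurrence-complete : ∀ {k m} (a : h k) (c : h m) T → Occurrence a c T → isOccurrence a c T ≡ true
  isOccurrence-complete {k} {m} a c T (occurrence ι ι-inj image≡T res≡a) =
    Any⇒any≡true (check H a c T) (allFuns H k m) (Any.map
      (λ {g} g≗ι → check-complete a c T g (λ e → ι-inj (trans (sym (g≗ι _)) (trans e (g≗ι _))))
                     (trans (image-cong g≗ι) image≡T) (trans (res-irr g ι _ ι-inj g≗ι c) res≡a))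
      (allFuns-complete k m ι))

  module _ {k m n} (a : h k) (b : h n) (σ : Fin m → Fin n) (σ-inj : Inj σ) (T : Subset m) where

    occurrence-res⁺ : Occurrence a (res σ σ-inj b) T → Occurrence a b (imageOn σ T)
    occurrence-res⁺ (occurrence ι ι-inj image≡T res≡a) =
      occurrence (σ ∘ ι) σι-inj image-σι (trans (res-∘ σ ι σ-inj ι-inj σι-inj b) res≡a)
      where
      σι-inj : Inj (σ ∘ ι)
      σι-inj = ι-inj ∘ σ-inj
      image-σι : image H (σ ∘ ι) ≡ imageOn σ T
      image-σι = subset-ext
        (λ j j∈ → let i , σιi≡j = ∈-image⁻ (σ ∘ ι) j j∈ in
                  ∈-imageOn⁺ σ T (subst (λ S → ι i ∈ₛ S) image≡T (∈-image⁺ ι i)) σιi≡j)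
        (λ j j∈ → let i , i∈T , σi≡j = ∈-imageOn⁻ σ T j j∈
                      x , ιx≡i = ∈-image⁻ ι i (subst (λ S → i ∈ₛ S) (sym image≡T) i∈T) in
                  subst (_∈ₛ image H (σ ∘ ι)) (trans (cong σ ιx≡i) σi≡j) (∈-image⁺ (σ ∘ ι) x))

    occurrence-res⁻ : Occurrence a b (imageOn σ T) → Occurrence a (res σ σ-inj b) T
    occurrence-res⁻ (occurrence ι′ ι′-inj image≡σT res≡a) = occurrence ι ι-inj image-ι res-ι
      where
      preimage : ∀ x → ∃ λ i → i ∈ₛ T × σ i ≡ ι′ x
      preimage x = ∈-imageOn⁻ σ T (ι′ x) (subst (λ S → ι′ x ∈ₛ S) image≡σT (∈-image⁺ ι′ x))
      ι : Fin k → Fin m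
      ι = proj₁ ∘ preimage
      σι≡ι′ : ∀ x → σ (ι x) ≡ ι′ x
      σι≡ι′ = proj₂ ∘ proj₂ ∘ preimage
      ι-inj : Inj ι
      ι-inj {x} {y} e = ι′-inj (trans (sym (σι≡ι′ x)) (trans (cong σ e) (σι≡ι′ y)))
      image-ι : image H ι ≡ T
      image-ι = subset-ext
        (λ j j∈ → let x , ιx≡j = ∈-image⁻ ι j j∈ in subst (_∈ₛ T) ιx≡j (proj₁ (proj₂ (preimage x))))
        (λ j j∈T → let σj∈ = subst (λ S → σ j ∈ₛ S) (sym image≡σT) (∈-imageOn⁺ σ T j∈T refl)
                       x , ι′x≡σj = ∈-image⁻ ι′ (σ j) σj∈ in
                   subst (_∈ₛ image H ι) (σ-inj (trans (σι≡ι′ x) ι′x≡σj)) (∈-image⁺ ι x))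
      res-ι : res ι ι-inj (res σ σ-inj b) ≡ a
      res-ι = trans (sym (res-∘ σ ι σ-inj ι-inj (ι-inj ∘ σ-inj) b)) (trans (res-irr (σ ∘ ι) ι′ _ ι′-inj σι≡ι′ b) res≡a)

    isOccurrence-res : isOccurrence a (res σ σ-inj b) T ≡ isOccurrence a b (imageOn σ T)
    isOccurrence-res = Bool.⇔→≡ (mk⇔
      (λ found → isOccurrence-complete a b (imageOn σ T) (occurrence-res⁺ (isOccurrence-sound a (res σ σ-inj b) T found)))
      (λ found → isOccurrence-complete a (res σ σ-inj b) T (occurrence-res⁻ (isOccurrence-sound a b (imageOn σ T) found))))

  δₛ : ∀ {n} → Subset n → Subset n → ℚ
  δₛ S T = 𝟙 (does (VP.≡-dec Bool._≟_ S T))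

  ∑-𝒫-δ : ∀ n (U : Subset n) (F : Subset n → ℚ) → ∑[ T ∈ 𝒫 n ] (δₛ U T * F T) ≡ F U
  ∑-𝒫-δ ℕ.zero  [] F = trans (+-identityʳ _) (*-identityˡ _)
  ∑-𝒫-δ (suc n) (true ∷ U) F = begin
    ∑[ T ∈ 𝒫 (suc n) ] (δₛ (true ∷ U) T * F T)
      ≡⟨ ∑-𝒫-suc n (λ T → δₛ (true ∷ U) T * F T) ⟩
    ∑[ T ∈ 𝒫 n ] (δₛ U T * F (true ∷ T) + 0ℚ * F (false ∷ T))
      ≡⟨ ∑-cong (𝒫 n) (λ T → trans (cong (δₛ U T * F (true ∷ T) +_) (*-zeroˡ (F (false ∷ T))))
                                   (+-identityʳ (δₛ U T * F (true ∷ T)))) ⟩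
    ∑[ T ∈ 𝒫 n ] (δₛ U T * F (true ∷ T))
      ≡⟨ ∑-𝒫-δ n U (F ∘ (true ∷_)) ⟩
    F (true ∷ U) ∎
    where open ≡-Reasoning
  ∑-𝒫-δ (suc n) (false ∷ U) F = begin
    ∑[ T ∈ 𝒫 (suc n) ] (δₛ (false ∷ U) T * F T)
      ≡⟨ ∑-𝒫-suc n (λ T → δₛ (false ∷ U) T * F T) ⟩
    ∑[ T ∈ 𝒫 n ] (0ℚ * F (true ∷ T) + δₛ U T * F (false ∷ T))
      ≡⟨ ∑-cong (𝒫 n) (λ T → trans (cong (_+ δₛ U T * F (false ∷ T)) (*-zeroˡ (F (true ∷ T))))
                                   (+-identityˡ (δₛ U T * F (false ∷ T)))) ⟩
    ∑[ T ∈ 𝒫 n ] (δₛ U T * F (false ∷ T))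
      ≡⟨ ∑-𝒫-δ n U (F ∘ (false ∷_)) ⟩
    F (false ∷ U) ∎
    where open ≡-Reasoning

  ∑-𝒫-bijection : ∀ n (f g : Subset n → Subset n) → (∀ U → g (f U) ≡ U) → (∀ T → f (g T) ≡ T) →
                  ∀ F → ∑[ U ∈ 𝒫 n ] F (f U) ≡ ∑ (𝒫 n) F
  ∑-𝒫-bijection n f g g∘f≗id f∘g≗id F = begin
    ∑[ U ∈ 𝒫 n ] F (f U)
      ≡⟨ ∑-cong (𝒫 n) (λ U → sym (∑-𝒫-δ n (f U) F)) ⟩
    ∑[ U ∈ 𝒫 n ] ∑[ T ∈ 𝒫 n ] (δₛ (f U) T * F T)
      ≡⟨ ∑-comm (𝒫 n) (𝒫 n) (λ U T → δₛ (f U) T * F T) ⟩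
    ∑[ T ∈ 𝒫 n ] ∑[ U ∈ 𝒫 n ] (δₛ (f U) T * F T)
      ≡⟨ ∑-cong (𝒫 n) (λ T → ∑-cong (𝒫 n) (λ U → cong (_* F T) (transpose U T))) ⟩
    ∑[ T ∈ 𝒫 n ] ∑[ U ∈ 𝒫 n ] (δₛ (g T) U * F T)
      ≡⟨ ∑-cong (𝒫 n) (λ T → ∑-𝒫-δ n (g T) (λ _ → F T)) ⟩
    ∑ (𝒫 n) F ∎
    where
    open ≡-Reasoning
    transpose : ∀ U T → δₛ (f U) T ≡ δₛ (g T) U
    transpose U T = cong 𝟙 (does-⇔ (mk⇔ (λ fU≡T → trans (sym (cong g fU≡T)) (g∘f≗id U))
                                          (λ gT≡U → trans (sym (cong f gT≡U)) (f∘g≗id T)))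
                                    (VP.≡-dec Bool._≟_ (f U) T) (VP.≡-dec Bool._≟_ (g T) U))

  pcount-as-∑ : ∀ {k n} (a : h k) (b : h n) → ℕtoℚ H (pcount H (k , a) (n , b)) ≡ ∑[ T ∈ 𝒫 n ] 𝟙 (isOccurrence a b T)
  pcount-as-∑ {n = n} a b = length-filterᵇ/1 (isOccurrence a b) (𝒫 n)

  pcount-invariant : ∀ {k n} (a : h k) (σ : Fin n → Fin n) (σ-inj : Inj σ) (b : h n) →
                     ℕtoℚ H (pcount H (k , a) (n , res σ σ-inj b)) ≡ ℕtoℚ H (pcount H (k , a) (n , b))
  pcount-invariant {k} {n} a σ σ-inj b = begin
    ℕtoℚ H (pcount H (k , a) (n , res σ σ-inj b))
      ≡⟨ pcount-as-∑ a (res σ σ-inj b) ⟩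
    ∑[ T ∈ 𝒫 n ] 𝟙 (isOccurrence a (res σ σ-inj b) T)
      ≡⟨ ∑-cong (𝒫 n) (λ T → cong 𝟙 (isOccurrence-res a b σ σ-inj T)) ⟩
    ∑[ T ∈ 𝒫 n ] 𝟙 (isOccurrence a b (imageOn σ T))
      ≡⟨ ∑-𝒫-bijection n (imageOn σ) (imageOn σ⁻¹) (imageOn-inverse σ σ⁻¹ σ⁻¹∘σ≗id) (imageOn-inverse σ⁻¹ σ σ∘σ⁻¹≗id)
                       (𝟙 ∘ isOccurrence a b) ⟩
    ∑[ T ∈ 𝒫 n ] 𝟙 (isOccurrence a b T)
      ≡⟨ sym (pcount-as-∑ a b) ⟩
    ℕtoℚ H (pcount H (k , a) (n , b)) ∎
    where
    open ≡-Reasoning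
    σ⁻¹ : Fin n → Fin n
    σ⁻¹ = proj₁ ∘ injective⇒surjective σ-inj
    σ∘σ⁻¹≗id : ∀ j → σ (σ⁻¹ j) ≡ j
    σ∘σ⁻¹≗id = proj₂ ∘ injective⇒surjective σ-inj
    σ⁻¹∘σ≗id : ∀ i → σ⁻¹ (σ i) ≡ i
    σ⁻¹∘σ≗id i = σ-inj (σ∘σ⁻¹≗id (σ i))

  pcomb-invariant : ∀ cs → Invariant H (pcomb H cs)
  pcomb-invariant []                  n σ σ-inj b = refl
  pcomb-invariant ((c , (k , a)) ∷ cs) n σ σ-inj b =
    cong₂ _+_ (cong (c *_) (pcount-invariant a σ σ-inj b)) (pcomb-invariant cs n σ σ-inj b)

  pcount-restrict : ∀ {k n} (a : h k) (b : h n) S →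
                    ℕtoℚ H (pcount H (k , a) (restrict b S)) ≡ ∑[ T ∈ 𝒫 ∣ S ∣ ] 𝟙 (isOccurrence a b (expand S T))
  pcount-restrict a b S = trans (pcount-as-∑ a (res (embed S) (embed-injective S) b)) (∑-cong (𝒫 ∣ S ∣) λ T →
    cong 𝟙 (trans (isOccurrence-res a b (embed S) (embed-injective S) T) (cong (isOccurrence a b) (imageOn-embed S T))))

  möbius-inversion : ∀ n (G : Subset n → ℚ) → ∑[ S ∈ 𝒫 n ] (sign S * ∑[ T ∈ 𝒫 ∣ S ∣ ] G (expand S T)) ≡ G ⊤
  möbius-inversion ℕ.zero  G = trans (+-identityʳ _) (trans (*-identityˡ _) (+-identityʳ _))
  möbius-inversion (suc n) G = begin
    ∑[ S ∈ 𝒫 (suc n) ] (sign S * ∑[ T ∈ 𝒫 ∣ S ∣ ] G (expand S T))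
      ≡⟨ ∑-𝒫-suc n (λ S → sign S * ∑[ T ∈ 𝒫 ∣ S ∣ ] G (expand S T)) ⟩
    ∑[ S ∈ 𝒫 n ] (sign S * ∑[ T ∈ 𝒫 (suc ∣ S ∣) ] G (expand (true ∷ S) T) + (- sign S) * Σ₀ S)
      ≡⟨ ∑-cong (𝒫 n) (λ S → cong (λ z → sign S * z + (- sign S) * Σ₀ S)
                                   (trans (∑-𝒫-suc ∣ S ∣ (G ∘ expand (true ∷ S)))
                                          (∑-distrib-+ (𝒫 ∣ S ∣) (G ∘ (true ∷_) ∘ expand S) (G ∘ (false ∷_) ∘ expand S)))) ⟩
    ∑[ S ∈ 𝒫 n ] (sign S * (Σ₁ S + Σ₀ S) + (- sign S) * Σ₀ S)
      ≡⟨ ∑-cong (𝒫 n) (λ S → solve 3 (λ s a b → s :* (a :+ b) :+ (:- s) :* b := s :* a) refl (sign S) (Σ₁ S) (Σ₀ S)) ⟩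
    ∑[ S ∈ 𝒫 n ] (sign S * Σ₁ S)
      ≡⟨ möbius-inversion n (G ∘ (true ∷_)) ⟩
    G ⊤ ∎
    where
    open ≡-Reasoning
    Σ₁ Σ₀ : Subset n → ℚ
    Σ₁ S = ∑[ T ∈ 𝒫 ∣ S ∣ ] G (true ∷ expand S T)
    Σ₀ S = ∑[ T ∈ 𝒫 ∣ S ∣ ] G (false ∷ expand S T)

  occurrence-⊤⇒≤ : ∀ {k n} {a : h k} {b : h n} → Occurrence a b ⊤ → n ≤ k
  occurrence-⊤⇒≤ {n = n} (occurrence ι _ image≡⊤ _) = Fin.injective⇒≤ ι⁻¹-injective
    where
    ι⁻¹ : ∀ j → ∃ λ i → ι i ≡ j
    ι⁻¹ j = ∈-image⁻ ι j (trans (cong (λ S → Vec.lookup S j) image≡⊤) (VP.lookup-replicate j true))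
    ι⁻¹-injective : Inj (proj₁ ∘ ι⁻¹)
    ι⁻¹-injective {x} {y} e = trans (sym (proj₂ (ι⁻¹ x))) (trans (cong ι e) (proj₂ (ι⁻¹ y)))

  isOccurrence-⊤ : ∀ {k n} (a : h k) (b : h n) → k < n → isOccurrence a b ⊤ ≡ false
  isOccurrence-⊤ a b k<n with isOccurrence a b ⊤ in found
  ... | false = refl
  ... | true  = ⊥-elim (ℕ.<⇒≱ k<n (occurrence-⊤⇒≤ (isOccurrence-sound a b ⊤ found)))

  ∑-sign-pcount-restrict : ∀ {k n} (a : h k) (b : h n) → k < n →
                           ∑[ S ∈ 𝒫 n ] (sign S * ℕtoℚ H (pcount H (k , a) (restrict b S))) ≡ 0ℚ
  ∑-sign-pcount-restrict {n = n} a b k<n = begin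
    ∑[ S ∈ 𝒫 n ] (sign S * ℕtoℚ H (pcount H (_ , a) (restrict b S)))
      ≡⟨ ∑-cong (𝒫 n) (λ S → cong (sign S *_) (pcount-restrict a b S)) ⟩
    ∑[ S ∈ 𝒫 n ] (sign S * ∑[ T ∈ 𝒫 ∣ S ∣ ] 𝟙 (isOccurrence a b (expand S T)))
      ≡⟨ möbius-inversion n (𝟙 ∘ isOccurrence a b) ⟩
    𝟙 (isOccurrence a b ⊤)
      ≡⟨ cong 𝟙 (isOccurrence-⊤ a b k<n) ⟩
    0ℚ ∎
    where open ≡-Reasoning

  module _ {K : ℕ} (cs : List (ℚ × Obj H)) (cs-small : All (λ t → size t ≤ K) cs) where

    pcomb-möbius : ∀ o → K < proj₁ o → lin H (pcomb H cs) (möbius o) ≡ 0ℚ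
    pcomb-möbius (n , b) K<n = begin
      lin H (pcomb H cs) (möbius (n , b))
        ≡⟨ lin-möbius (pcomb H cs) n b ⟩
      ∑[ S ∈ 𝒫 n ] (sign S * ∑[ t ∈ cs ] (proj₁ t * p t S))
        ≡⟨ ∑-cong (𝒫 n) (λ S → sym (∑-factorˡ cs (sign S) (λ t → proj₁ t * p t S))) ⟩
      ∑[ S ∈ 𝒫 n ] ∑[ t ∈ cs ] (sign S * (proj₁ t * p t S))
        ≡⟨ ∑-comm (𝒫 n) cs (λ S t → sign S * (proj₁ t * p t S)) ⟩
      ∑[ t ∈ cs ] ∑[ S ∈ 𝒫 n ] (sign S * (proj₁ t * p t S))
        ≡⟨ ∑-cong cs (λ t → ∑-cong (𝒫 n) (λ S →
             solve 3 (λ s c q → s :* (c :* q) := c :* (s :* q)) refl (sign S) (proj₁ t) (p t S))) ⟩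
      ∑[ t ∈ cs ] ∑[ S ∈ 𝒫 n ] (proj₁ t * (sign S * p t S))
        ≡⟨ ∑-cong cs (λ t → ∑-factorˡ (𝒫 n) (proj₁ t) (λ S → sign S * p t S)) ⟩
      ∑[ t ∈ cs ] (proj₁ t * ∑[ S ∈ 𝒫 n ] (sign S * p t S))
        ≡⟨ lin-vanishing {λ o → ∑[ S ∈ 𝒫 n ] (sign S * ℕtoℚ H (pcount H o (restrict b S)))} cs
             (All.map (λ {t} k≤K → ∑-sign-pcount-restrict (proj₂ (proj₂ t)) b (ℕ.≤-<-trans k≤K K<n)) cs-small) ⟩
      0ℚ ∎
      where
      open ≡-Reasoning
      p : ℚ × Obj H → Subset n → ℚ
      p t S = ℕtoℚ H (pcount H (proj₂ t) (restrict b S))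

    pcomb-vanishes-on-ideal : ∀ x → Ideal K x → lin H (pcomb H cs) x ≡ 0ℚ
    pcomb-vanishes-on-ideal x (w , w-large , x≋) = begin
      lin H (pcomb H cs) x                               ≡⟨ lin-≡ x≋ (pcomb H cs) (pcomb-invariant cs) ⟩
      lin H (pcomb H cs) (möbiusAlg w)                   ≡⟨ lin-möbiusAlg (pcomb H cs) w ⟩
      lin H (λ o → lin H (pcomb H cs) (möbius o)) w      ≡⟨ lin-vanishing w (All.map (λ {t} → pcomb-möbius (proj₂ t)) w-large) ⟩
      0ℚ                                                 ∎
      where open ≡-Reasoning

mainTheorem7 : (H : AssocPresheaf) (cs : List (ℚ × Obj H)) → InSweedler H (pcomb H cs)
mainTheorem7 H cs = Ideal H K , ideal-isIdeal H , ideal-finCodim H , pcomb-vanishes-on-ideal H cs sizes≤K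
  where
  K : ℕ
  K = max 0 (map (size H) cs)
  sizes≤K : All (λ t → size H t ≤ K) cs
  sizes≤K = AllP.map⁻ (xs≤max 0 (map (size H) cs))
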